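{- Let $p\equiv1\pmod 3$ be prime, $n\ge2$ and $D\ge1$. Let $\alpha_1,\alpha_2,\alpha_3\in\mathbb{Z}$ with $\max\{|\alpha_1|,|\alpha_2|,|\alpha_3|\}\le D$. Assume $p^{n/2}>20D^3$ and let $1\le u_0\le p^{\lfloor n/2\rfloor}-1$ be a primitive cube root of unity modulo $p^{\lfloor n/2\rfloor}$ (i.e. $u_0^3\equiv1$ and $u_0\not\equiv1 \pmod{p^{\lfloor n/2\rfloor}}$). Then either $\alpha_1=\alpha_2=\alpha_3$, or $$\nu_p(\alpha_1+\alpha_2u_0+\alpha_3u_0^2)\le\left\lceil\frac{\log(20D^3)}{\log p}\right\rceil.$$
   Context: $\nu_p$ denotes the $p$-adic valuation. -}

module Defs where

open import Data.Nat using (ℕ; zero; suc; _^_; _≤?_)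
open import Data.Integer using (ℤ; +_)
open import Data.Integer.Divisibility using (_∣_)
open import Relation.Nullary using (¬_; yes; no)

-- p-adic valuation bound:  ν_p(x) ≤ k  (with the convention ν_p(0) = ∞,
-- so this fails for x = 0).  Unfolds to: p^(k+1) does not divide x.
ν[_]_≤_ : ℕ → ℤ → ℕ → Set
ν[ p ] x ≤ k = ¬ ((+ (p ^ suc k)) ∣ x)

-- ceilLog b N = least c ∈ ℕ with N ≤ b ^ c, i.e. ⌈log N / log b⌉ for
-- b ≥ 2 and N ≥ 1.  The search starts at c = 0 with fuel N, which
-- suffices because b ^ N ≥ N for b ≥ 2.
ceilLogFrom : ℕ → ℕ → ℕ → ℕ → ℕ
ceilLogFrom b N c fuel with N ≤? b ^ c
... | yes _ = c
ceilLogFrom b N c zero | no _ = c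
ceilLogFrom b N c (suc f) | no _ = ceilLogFrom b N (suc c) f

ceilLog : ℕ → ℕ → ℕ
ceilLog b N = ceilLogFrom b N 0 N

{-# OPTIONS --safe #-}

-- Write x = α₁ + α₂u + α₃u², m = ⌊n/2⌋ and Φ₃(u) = u² + u + 1. As u is a
-- primitive cube root of unity modulo p^m and p ≠ 3, p^m divides Φ₃(u).
-- Modulo Φ₃(u), twice the product of x with its conjugate α₁ + α₂u² + α₃u is
-- (α₁−α₂)² + (α₂−α₃)² + (α₁−α₃)², which is nonzero and at most 12D²; so every
-- p^k with k ≤ m dividing x is at most 12D². Suppose p^(e+1) divides x, where
-- p^e ≥ 20D³. If e ≤ m this gives p^e ≤ 12D², absurd. If e > m ≥ 2 it gives
-- p^m ≤ 12D², contradicting p^(2m+1) ≥ p^n > 400D⁶. If m = 1 < e, then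
-- p³ divides x while |x| ≤ DΦ₃(u) < p³, so x = 0; this forces u ≤ D and hence
-- p ≤ Φ₃(u) ≤ 3D², again contradicting p³ > 400D⁶.

module Submission where

open import Defs
open import Data.Nat using (ℕ; _≤_; _<_; _*_; _^_; _∸_)
open import Data.Nat.DivMod using (_%_; _/_)
open import Data.Nat.Primality using (Prime)
open import Data.Integer using (ℤ; +_; ∣_∣) renaming (_+_ to _+ℤ_; _*_ to _*ℤ_)
open import Data.Nat.Divisibility renaming (_∣_ to _∣ℕ_)
open import Data.Product using (_×_)
open import Data.Sum using (_⊎_)
open import Relation.Nullary using (¬_)
open import Relation.Binary.PropositionalEquality using (_≡_)

open import Data.Nat using (zero; suc; _+_; _≤?_; z≤n; s≤s; s≤s⁻¹; NonZero; >-nonZero)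
open import Data.Nat.Properties
open import Data.Nat.DivMod using (m≡m%n+[m/n]*n; m%n<n; /-monoˡ-≤)
open import Data.Nat.Primality using (euclidsLemma; prime⇒nonZero; composite⇒¬prime; composite[4])
open import Data.Nat.Tactic.RingSolver using (solve-∀)
open import Data.Product using (_,_)
open import Data.Sum using (inj₁; inj₂; [_,_]′)
open import Function using (id)
open import Relation.Nullary using (yes; no; contradiction)
open import Relation.Nullary.Decidable using (_×-dec_)
open import Relation.Binary.PropositionalEquality using (_≢_; refl; sym; trans; cong; cong₂; subst; module ≡-Reasoning)
open import Data.Integer using (_-_; -_; 0ℤ; 1ℤ; -[1+_])
import Data.Integer as ℤ
import Data.Integer.Properties as ℤ
open import Algebra.Properties.AbelianGroup ℤ.+-0-abelianGroup using (inverseˡ-unique)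
import Data.Integer.Divisibility.Signed as Signed
import Data.Integer.Tactic.RingSolver as ℤ-Solver

n<m^n : ∀ {m} → 1 < m → ∀ n → n < m ^ n
n<m^n 1<m zero = s≤s z≤n
n<m^n {m} 1<m (suc n) = ≤-<-trans (n<m^n 1<m n) (^-monoʳ-< m 1<m (n<1+n n))

ceilLogFrom-spec : ∀ b N c fuel → N ≤ b ^ (fuel + c) → N ≤ b ^ ceilLogFrom b N c fuel
ceilLogFrom-spec b N c fuel N≤b^[f+c] with N ≤? b ^ c
... | yes N≤b^c = N≤b^c
ceilLogFrom-spec b N c zero    N≤b^c | no N≰b^c = contradiction N≤b^c N≰b^c
ceilLogFrom-spec b N c (suc f) N≤b^[f+c] | no _ =
  ceilLogFrom-spec b N (suc c) f (subst (λ k → N ≤ b ^ k) (sym (+-suc f c)) N≤b^[f+c])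

ceilLog-spec : ∀ b N → 1 < b → N ≤ b ^ ceilLog b N
ceilLog-spec b N 1<b =
  ceilLogFrom-spec b N 0 N (subst (λ k → N ≤ b ^ k) (sym (+-identityʳ N)) (<⇒≤ (n<m^n 1<b N)))

^-monoʳ-∣ : ∀ m {i j} → i ≤ j → m ^ i ∣ℕ m ^ j
^-monoʳ-∣ m {i} {j} i≤j = divides (m ^ (j ∸ i)) (begin
  m ^ j             ≡⟨ cong (m ^_) (sym (m∸n+n≡m i≤j)) ⟩
  m ^ (j ∸ i + i)   ≡⟨ ^-distribˡ-+-* m (j ∸ i) i ⟩
  m ^ (j ∸ i) * m ^ i ∎)
  where open ≡-Reasoning

p^k∣m*n⇒p^k∣m : ∀ {p n} → Prime p → ¬ p ∣ℕ n → ∀ k {m} → p ^ k ∣ℕ m * n → p ^ k ∣ℕ m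
p^k∣m*n⇒p^k∣m pp p∤n zero {m} _ = 1∣ m
p^k∣m*n⇒p^k∣m {p} {n} pp p∤n (suc k) {m} p^[1+k]∣mn
  with euclidsLemma m n pp (∣-trans (m∣m*n (p ^ k)) p^[1+k]∣mn)
... | inj₂ p∣n = contradiction p∣n p∤n
... | inj₁ (divides q refl) = ∣-trans (*-monoʳ-∣ p p^k∣q) (∣-reflexive (*-comm p q))
  where
  instance _ = prime⇒nonZero pp
  rearrange : ∀ q p n → q * p * n ≡ p * (q * n)
  rearrange = solve-∀
  p^k∣q : p ^ k ∣ℕ q
  p^k∣q = p^k∣m*n⇒p^k∣m pp p∤n k (*-cancelˡ-∣ p (subst (p ^ suc k ∣ℕ_) (rearrange q p n) p^[1+k]∣mn))

p^k∣m*n⇒p^k∣m⊎p^k∣n : ∀ {p m n} → Prime p → ¬ (p ∣ℕ m × p ∣ℕ n) →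
  ∀ k → p ^ k ∣ℕ m * n → p ^ k ∣ℕ m ⊎ p ^ k ∣ℕ n
p^k∣m*n⇒p^k∣m⊎p^k∣n {p} {m} {n} pp p∤m∧n k p^k∣mn with p ∣? n
... | no p∤n  = inj₁ (p^k∣m*n⇒p^k∣m pp p∤n k p^k∣mn)
... | yes p∣n = inj₂ (p^k∣m*n⇒p^k∣m pp (λ p∣m → p∤m∧n (p∣m , p∣n)) k
                       (subst (p ^ k ∣ℕ_) (*-comm m n) p^k∣mn))

prime%3≡1⇒7≤p : ∀ {p} → Prime p → p % 3 ≡ 1 → 7 ≤ p
prime%3≡1⇒7≤p {0} () _
prime%3≡1⇒7≤p {1} () _
prime%3≡1⇒7≤p {2} _ ()
prime%3≡1⇒7≤p {3} _ ()
prime%3≡1⇒7≤p {4} pp _ = contradiction pp (composite⇒¬prime composite[4])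
prime%3≡1⇒7≤p {5} _ ()
prime%3≡1⇒7≤p {6} _ ()
prime%3≡1⇒7≤p {suc (suc (suc (suc (suc (suc (suc k))))))} _ _ = m≤m+n 7 k

Φ₃ : ℕ → ℕ
Φ₃ u = u ^ 2 + u + 1

[1+w]^3∸1≡w*Φ₃[1+w] : ∀ w → suc w ^ 3 ∸ 1 ≡ w * Φ₃ (suc w)
[1+w]^3∸1≡w*Φ₃[1+w] w = cong (_∸ 1) (identity w)
  where
  -- solve-∀ does not look through _^_, so here and below powers are unfolded.
  identity : ∀ w → (1 + w) * ((1 + w) * ((1 + w) * 1))
                 ≡ 1 + w * ((1 + w) * ((1 + w) * 1) + (1 + w) + 1)
  identity = solve-∀

Φ₃[1+w]≡w*[w+3]+3 : ∀ w → Φ₃ (suc w) ≡ w * (w + 3) + 3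
Φ₃[1+w]≡w*[w+3]+3 = identity
  where
  identity : ∀ w → (1 + w) * ((1 + w) * 1) + (1 + w) + 1 ≡ w * (w + 3) + 3
  identity = solve-∀

cubeRoot⇒p^k∣Φ₃ : ∀ {p} → Prime p → ¬ p ∣ℕ 3 → ∀ k u → 1 ≤ u →
  p ^ k ∣ℕ u ^ 3 ∸ 1 → ¬ p ^ k ∣ℕ u ∸ 1 → p ^ k ∣ℕ Φ₃ u
cubeRoot⇒p^k∣Φ₃ {p} pp p∤3 k (suc w) _ p^k∣u³∸1 p^k∤w =
  [ (λ p^k∣w → contradiction p^k∣w p^k∤w) , id ]′
    (p^k∣m*n⇒p^k∣m⊎p^k∣n pp p∤w∧Φ₃ k (subst (p ^ k ∣ℕ_) ([1+w]^3∸1≡w*Φ₃[1+w] w) p^k∣u³∸1))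
  where
  p∤w∧Φ₃ : ¬ (p ∣ℕ w × p ∣ℕ Φ₃ (suc w))
  p∤w∧Φ₃ (p∣w , p∣Φ₃) =
    p∤3 (∣m+n∣m⇒∣n (subst (p ∣ℕ_) (Φ₃[1+w]≡w*[w+3]+3 w) p∣Φ₃) (∣m⇒∣m*n (w + 3) p∣w))

quad : ℤ → ℤ → ℤ → ℕ → ℤ
quad a b c u = a +ℤ b *ℤ + u +ℤ c *ℤ + (u ^ 2)

+[u^2]≡+u*+u : ∀ u → + (u ^ 2) ≡ + u *ℤ + u
+[u^2]≡+u*+u u = trans (ℤ.pos-* u (u * 1)) (cong (λ v → + u *ℤ + v) (*-identityʳ u))

spread : ℤ → ℤ → ℤ → ℕ
spread a b c = ∣ a - b ∣ * ∣ a - b ∣ + ∣ b - c ∣ * ∣ b - c ∣ + ∣ a - c ∣ * ∣ a - c ∣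

+[∣i∣*∣i∣]≡i*i : ∀ i → + (∣ i ∣ * ∣ i ∣) ≡ i *ℤ i
+[∣i∣*∣i∣]≡i*i (+ zero)  = refl
+[∣i∣*∣i∣]≡i*i (+ suc n) = refl
+[∣i∣*∣i∣]≡i*i -[1+ n ]  = refl

+spread≡ : ∀ a b c →
  + spread a b c ≡ (a - b) *ℤ (a - b) +ℤ (b - c) *ℤ (b - c) +ℤ (a - c) *ℤ (a - c)
+spread≡ a b c = cong₂ _+ℤ_
  (cong₂ _+ℤ_ (+[∣i∣*∣i∣]≡i*i (a - b)) (+[∣i∣*∣i∣]≡i*i (b - c))) (+[∣i∣*∣i∣]≡i*i (a - c))

-- Modulo U² + U + 1 we have U³ ≡ 1, so the product of the conjugates
-- a + bU + cU² and a + bU² + cU is a² + b² + c² − ab − bc − ca.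
conjugate-product : ∀ a b c U →
  + 2 *ℤ (a +ℤ b *ℤ U +ℤ c *ℤ (U *ℤ U)) *ℤ (a +ℤ b *ℤ (U *ℤ U) +ℤ c *ℤ U)
  ≡ (a - b) *ℤ (a - b) +ℤ (b - c) *ℤ (b - c) +ℤ (a - c) *ℤ (a - c)
    +ℤ (U *ℤ U +ℤ U +ℤ 1ℤ)
       *ℤ (+ 2 *ℤ ((b *ℤ b +ℤ c *ℤ c) *ℤ (U - 1ℤ) +ℤ b *ℤ c *ℤ U *ℤ (U - 1ℤ)
                   +ℤ (a *ℤ b +ℤ a *ℤ c +ℤ b *ℤ c)))
conjugate-product = ℤ-Solver.solve-∀

∣quad∧∣Φ₃⇒∣spread : ∀ {k} a b c u → k ∣ℕ ∣ quad a b c u ∣ → k ∣ℕ Φ₃ u → k ∣ℕ spread a b c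
∣quad∧∣Φ₃⇒∣spread {k} a b c u k∣x k∣Φ₃ =
  Signed.∣⇒∣ᵤ (subst (+ k Signed.∣_) (sym (+spread≡ a b c)) k∣M)
  where
  U = + u
  k∣x′ : + k Signed.∣ a +ℤ b *ℤ U +ℤ c *ℤ (U *ℤ U)
  k∣x′ = subst (λ t → + k Signed.∣ a +ℤ b *ℤ U +ℤ c *ℤ t) (+[u^2]≡+u*+u u) (Signed.∣ᵤ⇒∣ k∣x)
  k∣Φ₃′ : + k Signed.∣ U *ℤ U +ℤ U +ℤ 1ℤ
  k∣Φ₃′ = subst (λ t → + k Signed.∣ t +ℤ U +ℤ 1ℤ) (+[u^2]≡+u*+u u) (Signed.∣ᵤ⇒∣ k∣Φ₃)
  k∣M = Signed.∣m+n∣n⇒∣m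
    (subst (+ k Signed.∣_) (conjugate-product a b c U)
      (Signed.∣m⇒∣m*n (a +ℤ b *ℤ (U *ℤ U) +ℤ c *ℤ U) (Signed.∣n⇒∣m*n (+ 2) k∣x′)))
    (Signed.∣m⇒∣m*n _ k∣Φ₃′)

∣i-j∣*∣i-j∣>0 : ∀ {i j} → i ≢ j → 0 < ∣ i - j ∣ * ∣ i - j ∣
∣i-j∣*∣i-j∣>0 {i} {j} i≢j with ∣ i - j ∣ in ∣i-j∣≡n
... | zero  = contradiction (ℤ.i-j≡0⇒i≡j i j (ℤ.∣i∣≡0⇒i≡0 ∣i-j∣≡n)) i≢j
... | suc _ = s≤s z≤n

spread>0 : ∀ {a b c} → ¬ (a ≡ b × b ≡ c) → 0 < spread a b c
spread>0 {a} {b} {c} ¬a≡b≡c with a ℤ.≟ b | b ℤ.≟ c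
... | yes a≡b | yes b≡c = contradiction (a≡b , b≡c) ¬a≡b≡c
... | no a≢b  | _       = <-≤-trans (∣i-j∣*∣i-j∣>0 a≢b) (≤-trans (m≤m+n _ _) (m≤m+n _ _))
... | yes _   | no b≢c  =
  <-≤-trans (∣i-j∣*∣i-j∣>0 b≢c) (≤-trans (m≤n+m _ (∣ a - b ∣ * ∣ a - b ∣)) (m≤m+n _ _))

linear-root-bound : ∀ a y u → a +ℤ + u *ℤ y ≡ 0ℤ → u ≤ ∣ a ∣ ⊎ (a ≡ 0ℤ × y ≡ 0ℤ)
linear-root-bound a y u a+uy≡0 with y ℤ.≟ 0ℤ
... | yes y≡0 = inj₂ (a≡0 , y≡0)
  where
  open ≡-Reasoning
  a≡0 : a ≡ 0ℤ
  a≡0 = begin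
    a                ≡⟨ inverseˡ-unique a _ a+uy≡0 ⟩
    - (+ u *ℤ y)     ≡⟨ cong (λ t → - (+ u *ℤ t)) y≡0 ⟩
    - (+ u *ℤ 0ℤ)    ≡⟨ cong -_ (ℤ.*-zeroʳ (+ u)) ⟩
    0ℤ               ∎
... | no y≢0 = inj₁ (begin
  u                ≤⟨ m≤m*n u ∣ y ∣ {{ℤ.≢-nonZero y≢0}} ⟩
  u * ∣ y ∣        ≡⟨ ℤ.abs-* (+ u) y ⟨
  ∣ + u *ℤ y ∣     ≡⟨ ℤ.∣-i∣≡∣i∣ (+ u *ℤ y) ⟨
  ∣ - (+ u *ℤ y) ∣ ≡⟨ cong ∣_∣ (inverseˡ-unique a _ a+uy≡0) ⟨
  ∣ a ∣            ∎)
  where open ≤-Reasoning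

module BoundedCoefficients {D : ℕ} {a b c : ℤ}
         (∣a∣≤D : ∣ a ∣ ≤ D) (∣b∣≤D : ∣ b ∣ ≤ D) (∣c∣≤D : ∣ c ∣ ≤ D) where

  spread≤12*D^2 : spread a b c ≤ 12 * D ^ 2
  spread≤12*D^2 = ≤-trans
    (+-mono-≤ (+-mono-≤ (square≤ a b ∣a∣≤D ∣b∣≤D) (square≤ b c ∣b∣≤D ∣c∣≤D))
              (square≤ a c ∣a∣≤D ∣c∣≤D))
    (≤-reflexive (identity D))
    where
    square≤ : ∀ i j → ∣ i ∣ ≤ D → ∣ j ∣ ≤ D → ∣ i - j ∣ * ∣ i - j ∣ ≤ (D + D) * (D + D)
    square≤ i j ∣i∣≤D ∣j∣≤D = *-mono-≤ ∣i-j∣≤2D ∣i-j∣≤2D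
      where ∣i-j∣≤2D = ≤-trans (ℤ.∣i-j∣≤∣i∣+∣j∣ i j) (+-mono-≤ ∣i∣≤D ∣j∣≤D)
    identity : ∀ D → (D + D) * (D + D) + (D + D) * (D + D) + (D + D) * (D + D) ≡ 12 * (D * (D * 1))
    identity = solve-∀

  ∣quad∣≤D*Φ₃ : ∀ u → ∣ quad a b c u ∣ ≤ D * Φ₃ u
  ∣quad∣≤D*Φ₃ u = begin
    ∣ a +ℤ b *ℤ + u +ℤ c *ℤ + (u ^ 2) ∣        ≤⟨ ℤ.∣i+j∣≤∣i∣+∣j∣ (a +ℤ b *ℤ + u) _ ⟩
    ∣ a +ℤ b *ℤ + u ∣ + ∣ c *ℤ + (u ^ 2) ∣      ≤⟨ +-monoˡ-≤ _ (ℤ.∣i+j∣≤∣i∣+∣j∣ a _) ⟩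
    ∣ a ∣ + ∣ b *ℤ + u ∣ + ∣ c *ℤ + (u ^ 2) ∣   ≡⟨ cong₂ (λ s t → ∣ a ∣ + s + t)
                                                         (ℤ.abs-* b (+ u)) (ℤ.abs-* c (+ (u ^ 2))) ⟩
    ∣ a ∣ + ∣ b ∣ * u + ∣ c ∣ * u ^ 2           ≤⟨ +-mono-≤ (+-monoʳ-≤ ∣ a ∣ (*-monoˡ-≤ u ∣b∣≤D))
                                                          (*-monoˡ-≤ (u ^ 2) ∣c∣≤D) ⟩
    ∣ a ∣ + D * u + D * u ^ 2                   ≤⟨ +-monoˡ-≤ _ (+-monoˡ-≤ _ ∣a∣≤D) ⟩
    D + D * u + D * u ^ 2                       ≡⟨ identity D u ⟩
    D * Φ₃ u                                    ∎
    where
    open ≤-Reasoning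
    identity : ∀ D u → D + D * u + D * (u * (u * 1)) ≡ D * (u * (u * 1) + u + 1)
    identity = solve-∀

  quad≡0⇒u≤D : ∀ u → ¬ (a ≡ b × b ≡ c) → quad a b c u ≡ 0ℤ → u ≤ D
  quad≡0⇒u≤D u ¬a≡b≡c x≡0 with linear-root-bound a (b +ℤ U *ℤ c) u horner
    where
    U = + u
    identity : ∀ a b c U → a +ℤ b *ℤ U +ℤ c *ℤ (U *ℤ U) ≡ a +ℤ U *ℤ (b +ℤ U *ℤ c)
    identity = ℤ-Solver.solve-∀
    horner : a +ℤ U *ℤ (b +ℤ U *ℤ c) ≡ 0ℤ
    horner = trans (sym (identity a b c U))
                   (trans (cong (λ t → a +ℤ b *ℤ U +ℤ c *ℤ t) (sym (+[u^2]≡+u*+u u))) x≡0)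
  ... | inj₁ u≤∣a∣ = ≤-trans u≤∣a∣ ∣a∣≤D
  ... | inj₂ (a≡0 , b+uc≡0) with linear-root-bound b c u b+uc≡0
  ...   | inj₁ u≤∣b∣ = ≤-trans u≤∣b∣ ∣b∣≤D
  ...   | inj₂ (b≡0 , c≡0) = contradiction (trans a≡0 (sym b≡0) , trans b≡0 (sym c≡0)) ¬a≡b≡c

m∣n∧n<m⇒n≡0 : ∀ {m n} → m ∣ℕ n → n < m → n ≡ 0
m∣n∧n<m⇒n≡0 {n = zero}  _   _   = refl
m∣n∧n<m⇒n≡0 {n = suc _} m∣n n<m = contradiction (∣⇒≤ m∣n) (<⇒≱ n<m)

Φ₃-mono-≤ : ∀ {u v} → u ≤ v → Φ₃ u ≤ Φ₃ v
Φ₃-mono-≤ u≤v = +-monoˡ-≤ 1 (+-mono-≤ (^-monoˡ-≤ 2 u≤v) u≤v)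

Φ₃≤n*n : ∀ {u n} → u < n → Φ₃ u ≤ n * n
Φ₃≤n*n {u} {n} u<n = begin
  Φ₃ u                ≤⟨ m≤m+n (Φ₃ u) u ⟩
  Φ₃ u + u            ≡⟨ identity u ⟨
  suc u * suc u       ≤⟨ *-mono-≤ u<n u<n ⟩
  n * n               ∎
  where
  open ≤-Reasoning
  identity : ∀ u → (1 + u) * (1 + u) ≡ u * (u * 1) + u + 1 + u
  identity = solve-∀

Φ₃≤3*n^2 : ∀ {n} → 1 ≤ n → Φ₃ n ≤ 3 * n ^ 2
Φ₃≤3*n^2 {n} 1≤n = begin
  n ^ 2 + n + 1          ≤⟨ +-mono-≤ (+-monoʳ-≤ (n ^ 2) n≤n^2) 1≤n^2 ⟩
  n ^ 2 + n ^ 2 + n ^ 2  ≡⟨ identity (n ^ 2) ⟩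
  3 * n ^ 2              ∎
  where
  open ≤-Reasoning
  instance _ = >-nonZero 1≤n
  n≤n^2 : n ≤ n ^ 2
  n≤n^2 = m≤m*n n (n ^ 1) {{m^n≢0 n 1}}
  1≤n^2 : 1 ≤ n ^ 2
  1≤n^2 = ≤-trans 1≤n n≤n^2
  identity : ∀ x → x + x + x ≡ 3 * x
  identity = solve-∀

12*n^2<20*n^3 : ∀ {n} → 1 ≤ n → 12 * n ^ 2 < 20 * n ^ 3
12*n^2<20*n^3 {n} 1≤n = <-≤-trans
  (*-monoˡ-< (n ^ 2) {{m^n≢0 n 2}} (m≤m+n 13 7))
  (*-monoʳ-≤ 20 (m≤n*m (n ^ 2) n))
  where instance _ = >-nonZero 1≤n

400*n^6<m^3⇒n<m : ∀ m n → 1 ≤ n → 400 * n ^ 6 < m ^ 3 → n < m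
400*n^6<m^3⇒n<m m n 1≤n 400n⁶<m³ = ≰⇒> λ m≤n → <⇒≱ 400n⁶<m³ (begin
  m ^ 3            ≤⟨ ^-monoˡ-≤ 3 m≤n ⟩
  n ^ 3            ≤⟨ m≤m*n (n ^ 3) (n ^ 3) {{m^n≢0 n 3}} ⟩
  n ^ 3 * n ^ 3    ≡⟨ ^-distribˡ-+-* n 3 3 ⟨
  n ^ 6            ≤⟨ m≤n*m (n ^ 6) 400 ⟩
  400 * n ^ 6      ∎)
  where
  open ≤-Reasoning
  instance _ = >-nonZero 1≤n

m≤3*n^2⇒m^3≤400*n^6 : ∀ {m} n → m ≤ 3 * n ^ 2 → m ^ 3 ≤ 400 * n ^ 6
m≤3*n^2⇒m^3≤400*n^6 {m} n m≤3n² = begin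
  m ^ 3               ≤⟨ ^-monoˡ-≤ 3 m≤3n² ⟩
  (3 * n ^ 2) ^ 3     ≡⟨ identity n ⟩
  27 * n ^ 6          ≤⟨ *-monoˡ-≤ (n ^ 6) (m≤m+n 27 373) ⟩
  400 * n ^ 6         ∎
  where
  open ≤-Reasoning
  identity : ∀ n → (3 * (n * (n * 1))) * ((3 * (n * (n * 1))) * ((3 * (n * (n * 1))) * 1))
                 ≡ 27 * (n * (n * (n * (n * (n * (n * 1))))))
  identity = solve-∀

p^[m+1+m]≤400*n^6 : ∀ {p} n m → 7 ≤ p → 2 ≤ m → p ^ m ≤ 12 * n ^ 2 → p ^ (m + suc m) ≤ 400 * n ^ 6
p^[m+1+m]≤400*n^6 {p} n m 7≤p 2≤m q≤12n² = *-cancelˡ-≤ 7 (begin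
  7 * p ^ (m + suc m)     ≡⟨ cong (7 *_) (^-distribˡ-+-* p m (suc m)) ⟩
  7 * (q * (p * q))       ≡⟨ rearrange q p ⟩
  q * (7 * p * q)         ≤⟨ *-monoʳ-≤ q (*-monoˡ-≤ q 7p≤q) ⟩
  q * (q * q)             ≤⟨ *-mono-≤ q≤12n² (*-mono-≤ q≤12n² q≤12n²) ⟩
  12 * n ^ 2 * (12 * n ^ 2 * (12 * n ^ 2)) ≡⟨ identity n ⟩
  1728 * n ^ 6            ≤⟨ *-monoˡ-≤ (n ^ 6) (m≤m+n 1728 1072) ⟩
  2800 * n ^ 6            ≡⟨ *-assoc 7 400 (n ^ 6) ⟩
  7 * (400 * n ^ 6)       ∎)
  where
  open ≤-Reasoning
  q = p ^ m
  instance _ = >-nonZero (≤-trans (s≤s z≤n) 7≤p)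
  7p≤q : 7 * p ≤ q
  7p≤q = begin
    7 * p    ≤⟨ *-monoˡ-≤ p 7≤p ⟩
    p * p    ≡⟨ cong (p *_) (*-identityʳ p) ⟨
    p ^ 2    ≤⟨ ^-monoʳ-≤ p 2≤m ⟩
    q        ∎
  rearrange : ∀ q p → 7 * (q * (p * q)) ≡ q * (7 * p * q)
  rearrange = solve-∀
  identity : ∀ n → 12 * (n * (n * 1)) * (12 * (n * (n * 1)) * (12 * (n * (n * 1))))
                 ≡ 1728 * (n * (n * (n * (n * (n * (n * 1))))))
  identity = solve-∀

module _ {p D : ℕ} {a b c : ℤ} (7≤p : 7 ≤ p) (1≤D : 1 ≤ D)
         (∣a∣≤D : ∣ a ∣ ≤ D) (∣b∣≤D : ∣ b ∣ ≤ D) (∣c∣≤D : ∣ c ∣ ≤ D)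
         (¬a≡b≡c : ¬ (a ≡ b × b ≡ c)) where

  open BoundedCoefficients {a = a} {b} {c} ∣a∣≤D ∣b∣≤D ∣c∣≤D

  private instance
    p≢0 : NonZero p
    p≢0 = >-nonZero (≤-trans (s≤s z≤n) 7≤p)

  ∣quad∧∣Φ₃⇒≤12*D^2 : ∀ {k} u → k ∣ℕ ∣ quad a b c u ∣ → k ∣ℕ Φ₃ u → k ≤ 12 * D ^ 2
  ∣quad∧∣Φ₃⇒≤12*D^2 u k∣x k∣Φ₃ =
    ≤-trans (∣⇒≤ {{>-nonZero (spread>0 ¬a≡b≡c)}} (∣quad∧∣Φ₃⇒∣spread a b c u k∣x k∣Φ₃))
            spread≤12*D^2

  p^3∤quad : ∀ u → 400 * D ^ 6 < p ^ 3 → p ∣ℕ Φ₃ u → u < p → ¬ p ^ 3 ∣ℕ ∣ quad a b c u ∣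
  p^3∤quad u 400D⁶<p³ p∣Φ₃ u<p p³∣x = <⇒≱ 400D⁶<p³ (m≤3*n^2⇒m^3≤400*n^6 D p≤3D²)
    where
    open ≤-Reasoning
    ∣x∣<p³ : ∣ quad a b c u ∣ < p ^ 3
    ∣x∣<p³ = begin-strict
      ∣ quad a b c u ∣  ≤⟨ ∣quad∣≤D*Φ₃ u ⟩
      D * Φ₃ u          ≤⟨ *-monoʳ-≤ D (Φ₃≤n*n u<p) ⟩
      D * (p * p)       <⟨ *-monoˡ-< (p * p) {{m*n≢0 p p}} (400*n^6<m^3⇒n<m p D 1≤D 400D⁶<p³) ⟩
      p * (p * p)       ≡⟨ cong (λ t → p * (p * t)) (*-identityʳ p) ⟨
      p ^ 3             ∎
    u≤D : u ≤ D
    u≤D = quad≡0⇒u≤D u ¬a≡b≡c (ℤ.∣i∣≡0⇒i≡0 (m∣n∧n<m⇒n≡0 p³∣x ∣x∣<p³))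
    p≤3D² : p ≤ 3 * D ^ 2
    p≤3D² = begin
      p         ≤⟨ ∣⇒≤ {{>-nonZero (m≤n+m 1 (u ^ 2 + u))}} p∣Φ₃ ⟩
      Φ₃ u      ≤⟨ Φ₃-mono-≤ u≤D ⟩
      Φ₃ D      ≤⟨ Φ₃≤3*n^2 1≤D ⟩
      3 * D ^ 2 ∎

  valuation-bound : ∀ m e u → 1 ≤ m → 400 * D ^ 6 < p ^ (m + suc m) → 20 * D ^ 3 ≤ p ^ e →
    p ^ m ∣ℕ Φ₃ u → u < p ^ m → ¬ p ^ suc e ∣ℕ ∣ quad a b c u ∣
  valuation-bound m e u _ _ 20D³≤p^e p^m∣Φ₃ _ p^[1+e]∣x with e ≤? m
  ... | yes e≤m = <⇒≱ (12*n^2<20*n^3 1≤D) (≤-trans 20D³≤p^e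
          (∣quad∧∣Φ₃⇒≤12*D^2 u (∣-trans (^-monoʳ-∣ p (n≤1+n e)) p^[1+e]∣x)
                                (∣-trans (^-monoʳ-∣ p e≤m) p^m∣Φ₃)))
  valuation-bound 1 e u _ 400D⁶<p³ _ p^1∣Φ₃ u<p^1 p^[1+e]∣x | no e≰1 =
    p^3∤quad u 400D⁶<p³ (subst (_∣ℕ Φ₃ u) (*-identityʳ p) p^1∣Φ₃) (subst (u <_) (*-identityʳ p) u<p^1)
      (∣-trans (^-monoʳ-∣ p (s≤s (≰⇒> e≰1))) p^[1+e]∣x)
  valuation-bound m@(suc (suc _)) e u _ 400D⁶<p^[2m+1] _ p^m∣Φ₃ _ p^[1+e]∣x | no e≰m =
    <⇒≱ 400D⁶<p^[2m+1] (p^[m+1+m]≤400*n^6 D m 7≤p (s≤s (s≤s z≤n))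
      (∣quad∧∣Φ₃⇒≤12*D^2 u (∣-trans (^-monoʳ-∣ p (m≤n⇒m≤1+n (<⇒≤ (≰⇒> e≰m)))) p^[1+e]∣x)
                            p^m∣Φ₃))

n≤[n/2]+suc[n/2] : ∀ n → n ≤ n / 2 + suc (n / 2)
n≤[n/2]+suc[n/2] n = begin
  n                     ≡⟨ m≡m%n+[m/n]*n n 2 ⟩
  n % 2 + n / 2 * 2     ≤⟨ +-monoˡ-≤ (n / 2 * 2) (s≤s⁻¹ (m%n<n n 2)) ⟩
  1 + n / 2 * 2         ≡⟨ identity (n / 2) ⟩
  n / 2 + suc (n / 2)   ∎
  where
  open ≤-Reasoning
  identity : ∀ m → 1 + m * 2 ≡ m + (1 + m)
  identity = solve-∀

m≤n∸1⇒m<n : ∀ {m n} .{{_ : NonZero n}} → m ≤ n ∸ 1 → m < n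
m≤n∸1⇒m<n {m} {n} m≤n∸1 = m≤pred[n]⇒suc[m]≤n (subst (m ≤_) (sym (pred[m∸n]≡m∸[1+n] n 0)) m≤n∸1)

lemma4p3 : (p n D : ℕ) → Prime p → p % 3 ≡ 1 → 2 ≤ n → 1 ≤ D →
    (α₁ α₂ α₃ : ℤ) → ∣ α₁ ∣ ≤ D → ∣ α₂ ∣ ≤ D → ∣ α₃ ∣ ≤ D →
    400 * D ^ 6 < p ^ n →
    (u₀ : ℕ) → 1 ≤ u₀ → u₀ ≤ p ^ (n / 2) ∸ 1 →
    (p ^ (n / 2)) ∣ℕ (u₀ ^ 3 ∸ 1) → ¬ ((p ^ (n / 2)) ∣ℕ (u₀ ∸ 1)) →
    (α₁ ≡ α₂ × α₂ ≡ α₃)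
    ⊎ ν[ p ] (α₁ +ℤ α₂ *ℤ (+ u₀) +ℤ α₃ *ℤ (+ (u₀ ^ 2))) ≤ ceilLog p (20 * D ^ 3)
lemma4p3 p n D pp p%3≡1 2≤n 1≤D α₁ α₂ α₃ ∣α₁∣≤D ∣α₂∣≤D ∣α₃∣≤D 400D⁶<pⁿ
         u₀ 1≤u₀ u₀≤p^m∸1 p^m∣u₀³∸1 p^m∤u₀∸1
  with (α₁ ℤ.≟ α₂) ×-dec (α₂ ℤ.≟ α₃)
... | yes α₁≡α₂≡α₃ = inj₁ α₁≡α₂≡α₃
... | no ¬α₁≡α₂≡α₃ = inj₂ (valuation-bound 7≤p 1≤D ∣α₁∣≤D ∣α₂∣≤D ∣α₃∣≤D ¬α₁≡α₂≡α₃
        (n / 2) (ceilLog p (20 * D ^ 3)) u₀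
        (/-monoˡ-≤ 2 2≤n)
        (<-≤-trans 400D⁶<pⁿ (^-monoʳ-≤ p (n≤[n/2]+suc[n/2] n)))
        (ceilLog-spec p (20 * D ^ 3) (≤-trans (s≤s (s≤s z≤n)) 7≤p))
        (cubeRoot⇒p^k∣Φ₃ pp p∤3 (n / 2) u₀ 1≤u₀ p^m∣u₀³∸1 p^m∤u₀∸1)
        (m≤n∸1⇒m<n {{m^n≢0 p (n / 2)}} u₀≤p^m∸1))
  where
  instance _ = prime⇒nonZero pp
  7≤p : 7 ≤ p
  7≤p = prime%3≡1⇒7≤p pp p%3≡1
  p∤3 : ¬ p ∣ℕ 3
  p∤3 p∣3 = <⇒≱ (≤-trans (m≤m+n 4 3) 7≤p) (∣⇒≤ p∣3)
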